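{- Let $k\ge r\ge 2$ be integers and let $\mathcal{E}$ be an equation that is not $r$-regular. Then the Rado number $\operatorname{R}_k(\mathcal{E})$ does not exist.
   Context: All colorings are exact: an exact $k$-coloring of a set $S$ is a surjective map $S\to[k]$. A solution of an equation $\mathcal{E}$ in a set $S\subseteq\mathbb{N}_+$ is an assignment of values in $S$ to the variables of $\mathcal{E}$ satisfying it; it is monochromatic if all these values receive the same color. $\mathcal{E}$ is $r$-regular if every exact $r$-coloring of $\mathbb{N}_+$ admits a monochromatic solution of $\mathcal{E}$ in $\mathbb{N}_+$. Since an exact $k$-coloring of $[N]=\{1,\dots,N\}$ requires $N\ge k$, only $N\ge k$ are considered: the Rado number $\operatorname{R}_k(\mathcal{E})$ is the minimum integer $N\ge k$, if it exists, such that every exact $k$-coloring of $[N]$ contains a monochromatic solution of $\mathcal{E}$ in $[N]$. -}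

module Defs where

open import Level using (0ℓ)
open import Data.Nat using (ℕ; _≤_; _<_)
open import Data.Fin using (Fin)
open import Data.Product using (Σ; _×_; ∃)
open import Relation.Binary.PropositionalEquality using (_≡_)
open import Relation.Nullary using (¬_)

-- An equation in m variables, given by its set of solutions:
-- Sol x holds iff the assignment x (variable j ↦ x j) satisfies the equation.
record Equation : Set₁ where
  field
    nvars : ℕ
    Sol   : (Fin nvars → ℕ) → Set

open Equation public

-- A colouring with k colours; only its values on positive integers matter.
Coloring : ℕ → Set
Coloring k = ℕ → Fin k

ExactColoringℕ₊ : (r : ℕ) → Coloring r → Set
ExactColoringℕ₊ r c = (i : Fin r) → ∃ λ n → (1 ≤ n) × (c n ≡ i)

ExactColoring[_] : (N k : ℕ) → Coloring k → Set
ExactColoring[ N ] k c = (i : Fin k) → ∃ λ n → (1 ≤ n) × (n ≤ N) × (c n ≡ i)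

Monochromatic : ∀ {k} (E : Equation) → Coloring k → (Fin (nvars E) → ℕ) → Set
Monochromatic E c x = (j j′ : Fin (nvars E)) → c (x j) ≡ c (x j′)

MonoSolℕ₊ : ∀ {k} (E : Equation) → Coloring k → Set
MonoSolℕ₊ E c = Σ (Fin (nvars E) → ℕ) λ x →
  ((j : Fin (nvars E)) → 1 ≤ x j) × Sol E x × Monochromatic E c x

MonoSol[_] : ∀ {k} (N : ℕ) (E : Equation) → Coloring k → Set
MonoSol[ N ] E c = Σ (Fin (nvars E) → ℕ) λ x →
  ((j : Fin (nvars E)) → (1 ≤ x j) × (x j ≤ N)) × Sol E x × Monochromatic E c x

Regular : ℕ → Equation → Set
Regular r E = (c : Coloring r) → ExactColoringℕ₊ r c → MonoSolℕ₊ E c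

RadoProperty : ℕ → Equation → ℕ → Set
RadoProperty k E N = (c : Coloring k) → ExactColoring[ N ] k c → MonoSol[ N ] E c

IsRadoNumber : ℕ → Equation → ℕ → Set
IsRadoNumber k E N =
  (k ≤ N) × RadoProperty k E N × ((M : ℕ) → k ≤ M → RadoProperty k E M → N ≤ M)

RadoNumberExists : ℕ → Equation → Set
RadoNumberExists k E = ∃ λ N → IsRadoNumber k E N

-- Suppose N = R_k(E) existed. Any r-colouring c of ℕ₊ can be refined on [N] into an exact
-- k-colouring d, i.e. d n = d m implies c n = c m: since r ≤ k ≤ N, colour classes of c can
-- be split until exactly k non-empty classes remain. A monochromatic solution for d in [N]
-- is then monochromatic for c, so E would be r-regular.
module Submission where

open import Defs
open import Level using (0ℓ)
open import Data.Nat using (ℕ; zero; suc; pred; _≤_; z≤n; s≤s; NonZero)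
open import Data.Nat.Properties
  using (_≟_; ≤-refl; ≤-trans; <⇒≤; <⇒≢; m≤n⇒m<n∨m≡n; m≤n⇒m≤1+n; anyUpTo?)
open import Data.Nat.DivMod using (_mod_; m<n⇒m%n≡m)
open import Data.Fin as Fin using (Fin; toℕ; inject≤; punchOut)
open import Data.Fin.Properties
  using (toℕ-injective; toℕ-fromℕ<; toℕ<n; suc-injective; inject≤-injective; punchOut-injective)
open import Data.Product using (∃; Σ; _×_; _,_; proj₁)
open import Data.Sum using (_⊎_; inj₁; inj₂)
open import Function using (_∘_)
open import Relation.Nullary using (¬_; yes; no; contradiction)
open import Relation.Unary using (Pred; Decidable)
open import Relation.Binary.PropositionalEquality
  using (_≡_; _≢_; refl; sym; trans; cong; module ≡-Reasoning)

private variable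
  A B C : Set
  k N : ℕ

infix 4 _∈[_]
_∈[_] : ℕ → ℕ → Set
n ∈[ N ] = 1 ≤ n × n ≤ N

∈[suc]-split : ∀ {n} → n ∈[ suc N ] → n ∈[ N ] ⊎ n ≡ suc N
∈[suc]-split (1≤n , n≤1+N) with m≤n⇒m<n∨m≡n n≤1+N
... | inj₁ (s≤s n≤N) = inj₁ (1≤n , n≤N)
... | inj₂ n≡1+N     = inj₂ n≡1+N

searchIn[_] : (N : ℕ) {P : Pred ℕ 0ℓ} → Decidable P →
              (∃ λ m → m ∈[ N ] × P m) ⊎ (∀ {m} → m ∈[ N ] → ¬ P m)
searchIn[ N ] P? with anyUpTo? (P? ∘ suc) N
... | yes (m , m<N , Pm) = inj₁ (suc m , (s≤s z≤n , m<N) , Pm)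
... | no ∄               = inj₂ λ { {suc m} (_ , m<N) Pm → ∄ (m , m<N , Pm) }

RefinesOn : ℕ → (ℕ → A) → (ℕ → B) → Set
RefinesOn N d h = ∀ {n m} → n ∈[ N ] → m ∈[ N ] → d n ≡ d m → h n ≡ h m

refinesOn-trans : {d : ℕ → A} {e : ℕ → B} {h : ℕ → C} →
                  RefinesOn N d e → RefinesOn N e h → RefinesOn N d h
refinesOn-trans d⊑e e⊑h n∈ m∈ = e⊑h n∈ m∈ ∘ d⊑e n∈ m∈

refinesOn-injective : {f : A → B} {h : ℕ → A} →
                      (∀ {x y} → f x ≡ f y → x ≡ y) → RefinesOn N (f ∘ h) h
refinesOn-injective f-injective _ _ = f-injective

monochromatic-refinesOn : ∀ {j} (E : Equation) {d : Coloring k} {h : Coloring j}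
                          {x : Fin (nvars E) → ℕ} →
                          RefinesOn N d h → (∀ i → x i ∈[ N ]) →
                          Monochromatic E d x → Monochromatic E h x
monochromatic-refinesOn E d⊑h x∈ mono i i′ = d⊑h (x∈ i) (x∈ i′) (mono i i′)

ExactRefinement : ℕ → (k : ℕ) → (ℕ → A) → Set
ExactRefinement N k h = Σ (Coloring k) λ d → ExactColoring[ N ] k d × RefinesOn N d h

positionColoring : (N : ℕ) .{{_ : NonZero N}} → Coloring N
positionColoring N n = pred n mod N

toℕ-positionColoring : .{{_ : NonZero N}} {n : ℕ} → n ∈[ N ] →
                       toℕ (positionColoring N n) ≡ pred n
toℕ-positionColoring {n = suc n} (_ , n<N) = trans (toℕ-fromℕ< _) (m<n⇒m%n≡m n<N)

positionColoring-exact : .{{_ : NonZero N}} → ExactColoring[ N ] N (positionColoring N)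
positionColoring-exact i = suc (toℕ i) , s≤s z≤n , toℕ<n i ,
  toℕ-injective (toℕ-positionColoring (s≤s z≤n , toℕ<n i))

positionColoring-refinesOn : .{{_ : NonZero N}} (h : ℕ → A) →
                             RefinesOn N (positionColoring N) h
positionColoring-refinesOn h {suc n} {suc m} n∈ m∈ eq = cong (h ∘ suc) (begin
  n                                ≡⟨ toℕ-positionColoring n∈ ⟨
  toℕ (positionColoring _ (suc n)) ≡⟨ cong toℕ eq ⟩
  toℕ (positionColoring _ (suc m)) ≡⟨ toℕ-positionColoring m∈ ⟩
  m                                ∎)
  where open ≡-Reasoning

infixl 6 _[_]≔_
_[_]≔_ : (ℕ → A) → ℕ → A → ℕ → A
(f [ p ]≔ a) n with n ≟ p
... | yes _ = a
... | no _  = f n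

[]≔-updated : (f : ℕ → A) (p : ℕ) (a : A) → (f [ p ]≔ a) p ≡ a
[]≔-updated f p a with p ≟ p
... | yes _   = refl
... | no p≢p = contradiction refl p≢p

[]≔-unchanged : (f : ℕ → A) {p n : ℕ} (a : A) → n ≢ p → (f [ p ]≔ a) n ≡ f n
[]≔-unchanged f {p} {n} a n≢p with n ≟ p
... | yes n≡p = contradiction n≡p n≢p
... | no _    = refl

[]≔-below : (f : ℕ → A) (a : A) {n : ℕ} → n ∈[ N ] → (f [ suc N ]≔ a) n ≡ f n
[]≔-below f a (_ , n≤N) = []≔-unchanged f a (<⇒≢ (s≤s n≤N))

[]≔-attains : {f : ℕ → A} {a i : A} → (∃ λ n → 1 ≤ n × n ≤ N × f n ≡ i) →
              ∃ λ n → 1 ≤ n × n ≤ suc N × (f [ suc N ]≔ a) n ≡ i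
[]≔-attains {N = N} (n , 1≤n , n≤N , fn≡i) =
  n , 1≤n , m≤n⇒m≤1+n n≤N , trans ([]≔-below _ _ (1≤n , n≤N)) fn≡i

refinesOn-[]≔ : {d : ℕ → A} {h : ℕ → B} {a : A} → RefinesOn N d h →
                (∀ {m} → m ∈[ N ] → a ≡ d m → h (suc N) ≡ h m) →
                RefinesOn (suc N) (d [ suc N ]≔ a) h
refinesOn-[]≔ {N = N} {d = d} {h} {a} d⊑h top n∈ m∈ eq
  with ∈[suc]-split n∈ | ∈[suc]-split m∈
... | inj₁ n∈N | inj₁ m∈N = d⊑h n∈N m∈N
  (trans (sym ([]≔-below d a n∈N)) (trans eq ([]≔-below d a m∈N)))
... | inj₂ refl | inj₁ m∈N = top m∈N
  (trans (sym ([]≔-updated d (suc N) a)) (trans eq ([]≔-below d a m∈N)))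
... | inj₁ n∈N | inj₂ refl = sym (top n∈N
  (trans (sym ([]≔-updated d (suc N) a)) (trans (sym eq) ([]≔-below d a n∈N))))
... | inj₂ refl | inj₂ refl = refl

dropColour : (a : Fin (suc k)) → Fin k → Fin (suc k) → Fin k
dropColour a o j with a Fin.≟ j
... | yes _   = o
... | no a≢j = punchOut a≢j

dropColour-injective : {a j j′ : Fin (suc k)} {o : Fin k} → a ≢ j → a ≢ j′ →
                       dropColour a o j ≡ dropColour a o j′ → j ≡ j′
dropColour-injective {a = a} {j} {j′} a≢j a≢j′ with a Fin.≟ j | a Fin.≟ j′
... | yes a≡j | _        = contradiction a≡j a≢j
... | _       | yes a≡j′ = contradiction a≡j′ a≢j′
... | no p    | no p′    = punchOut-injective p p′

extendRepeated : {h : Coloring k} → ExactRefinement N k h →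
                 ∀ {m} → m ∈[ N ] → h m ≡ h (suc N) → ExactRefinement (suc N) k h
extendRepeated (d , exact , d⊑h) {m} m∈ hm≡ =
  d [ _ ]≔ d m ,
  []≔-attains ∘ exact ,
  refinesOn-[]≔ d⊑h λ m′∈ → trans (sym hm≡) ∘ d⊑h m∈ m′∈

extendFresh : {h : Coloring (suc k)} {o : Fin k} →
              (∀ {m} → m ∈[ N ] → h m ≢ h (suc N)) →
              ExactRefinement N k (dropColour (h (suc N)) o ∘ h) →
              ExactRefinement (suc N) (suc k) h
extendFresh {k = k} {N = N} {h} {o} fresh (d , exact , d⊑h′) =
  d′ , exact′ , refinesOn-[]≔ suc∘d⊑h (λ _ ())
  where
  d′ : Coloring (suc k)
  d′ = (Fin.suc ∘ d) [ suc N ]≔ Fin.zero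

  h′⊑h : RefinesOn N (dropColour (h (suc N)) o ∘ h) h
  h′⊑h n∈ m∈ = dropColour-injective (fresh n∈ ∘ sym) (fresh m∈ ∘ sym)

  suc∘d⊑h : RefinesOn N (Fin.suc ∘ d) h
  suc∘d⊑h = refinesOn-trans (refinesOn-injective suc-injective)
                            (refinesOn-trans d⊑h′ h′⊑h)

  exact′ : ExactColoring[ suc N ] (suc k) d′
  exact′ Fin.zero    = suc N , s≤s z≤n , ≤-refl , []≔-updated (Fin.suc ∘ d) (suc N) Fin.zero
  exact′ (Fin.suc i) with exact i
  ... | n , 1≤n , n≤N , dn≡i = []≔-attains (n , 1≤n , n≤N , cong Fin.suc dn≡i)

-- The point N + 1 takes the d-colour of an earlier point of the same h-colour if there is one;
-- otherwise it gets a colour of its own and [N] is refined with one colour fewer.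
-- When k = N + 1 all points are separated.
exactRefinement : k ≤ N → (h : Coloring k) → ExactRefinement N k h
exactRefinement {N = zero} z≤n h = h , (λ ()) , λ { (s≤s _ , ()) _ }
exactRefinement {zero} {suc N} _ h with h 1
... | ()
exactRefinement {suc k} {suc N} k≤1+N h with m≤n⇒m<n∨m≡n k≤1+N
... | inj₂ refl = positionColoring (suc N) , positionColoring-exact , positionColoring-refinesOn h
... | inj₁ (s≤s 1+k≤N) with searchIn[ N ] (λ m → h m Fin.≟ h (suc N))
...   | inj₁ (m , m∈ , hm≡) = extendRepeated (exactRefinement 1+k≤N h) m∈ hm≡
...   | inj₂ fresh =
  extendFresh fresh (exactRefinement (<⇒≤ 1+k≤N) (dropColour (h (suc N)) o ∘ h))
  where
  o : Fin k
  o = punchOut (fresh (s≤s z≤n , ≤-trans (s≤s z≤n) 1+k≤N) ∘ sym)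

mainTheorem4 : (k r : ℕ) → 2 ≤ r → r ≤ k → (E : Equation) →
    ¬ Regular r E → ¬ RadoNumberExists k E
mainTheorem4 k r _ r≤k E ¬regular (N , k≤N , rado , _) = ¬regular regular
  where
  regular : Regular r E
  regular c _ with exactRefinement k≤N (λ n → inject≤ (c n) r≤k)
  ... | d , exact , d⊑c′ with rado d exact
  ...   | x , x∈ , sol , mono =
    x , proj₁ ∘ x∈ , sol ,
    monochromatic-refinesOn E d⊑c x∈ mono
    where
    d⊑c : RefinesOn N d c
    d⊑c = refinesOn-trans d⊑c′ (refinesOn-injective (inject≤-injective r≤k r≤k _ _))
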